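{- Let $q$ be a prime power, let $D_1$ be a linear $[n,k]$ code over $\mathbb{F}_q$ with $k\times n$ generator matrix $G_1$, and let $f:\mathrm{MAut}(D_1)\to \mathrm{GL}(k,q)$ be the homomorphism defined by $f(P)G_1=G_1P$ for $P\in\mathrm{MAut}(D_1)$. Let $m$ be a positive integer and let $a,b\in\mathbb{F}_q^k$. Suppose that the column vectors $a^T$ and $b^T$ lie in the same orbit of the subgroup $\mathrm{im}(f)\le \mathrm{GL}(k,q)$ acting on column vectors by left multiplication. Then the $[n+m,k]$ codes over $\mathbb{F}_q$ with generator matrices \[ \begin{pmatrix} G_1 & a^T & \cdots & a^T\end{pmatrix} \quad\text{and}\quad \begin{pmatrix} G_1 & b^T & \cdots & b^T\end{pmatrix} \] (each with $m$ copies of the column $a^T$, respectively $b^T$, appended) are monomially equivalent.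
   Context: A linear $[n,k]$ code over $\mathbb{F}_q$ is a $k$-dimensional subspace of $\mathbb{F}_q^n$; a generator matrix is a $k\times n$ matrix whose rows form a basis. Two codes $C,C'$ over $\mathbb{F}_q$ of length $n$ are monomially equivalent if $C'=CM=\{cM\mid c\in C\}$ for some $n\times n$ monomial matrix $M$ over $\mathbb{F}_q$ (a permutation matrix times an invertible diagonal matrix). The monomial automorphism group $\mathrm{MAut}(C)$ is the group of monomial matrices $M$ with $CM=C$. For $P\in\mathrm{MAut}(D_1)$, the rows of $G_1P$ form another basis of $D_1$, so there is a unique $f(P)\in\mathrm{GL}(k,q)$ with $f(P)G_1=G_1P$; this $f$ is a homomorphism and $\mathrm{im}(f)$ denotes its image. $a^T$ denotes the transpose of $a$. -}

module Defs where

open import Level using (Level; _⊔_)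
open import Algebra.Bundles using (CommutativeRing)
open import Data.Nat as ℕ using (ℕ; _^_; _≤_)
open import Data.Nat.Primality using (Prime)
open import Data.Fin as Fin using (Fin)
open import Data.Fin.Permutation using (Permutation′; _⟨$⟩ʳ_)
open import Data.Vec.Functional using (Vector; _++_; replicate)
open import Data.Product using (Σ; ∃; ∃-syntax; _×_)
open import Relation.Nullary using (¬_; yes; no)
open import Relation.Binary.PropositionalEquality using (_≡_)

IsPrimePower : ℕ → Set
IsPrimePower q = ∃[ p ] ∃[ e ] (Prime p × 1 ≤ e × q ≡ p ^ e)

record Field (c ℓ : Level) : Set (Level.suc (c ⊔ ℓ)) where
  field
    commutativeRing : CommutativeRing c ℓ
  open CommutativeRing commutativeRing public
  field
    0≉1     : ¬ (0# ≈ 1#)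
    inverse : ∀ x → ¬ (x ≈ 0#) → ∃[ y ] (x * y ≈ 1#)

HasSize : ∀ {c ℓ} → Field c ℓ → ℕ → Set (c ⊔ ℓ)
HasSize F q = Σ (Fin q → Carrier) λ e →
  (∀ i j → e i ≈ e j → i ≡ j) × (∀ x → ∃[ i ] (e i ≈ x))
  where open Field F

module FieldDefs {c ℓ} (F : Field c ℓ) where
  open Field F
  open import Algebra.Properties.Monoid.Sum +-monoid using (sum)

  Vec : ℕ → Set c
  Vec n = Fin n → Carrier

  Mat : ℕ → ℕ → Set c
  Mat k n = Fin k → Fin n → Carrier

  _≋_ : ∀ {n} → Vec n → Vec n → Set ℓ
  u ≋ v = ∀ i → u i ≈ v i

  _≈ₘ_ : ∀ {k n} → Mat k n → Mat k n → Set ℓ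
  A ≈ₘ B = ∀ i j → A i j ≈ B i j

  _·_ : ∀ {k l n} → Mat k l → Mat l n → Mat k n
  (A · B) i j = sum λ t → A i t * B t j

  _⋆_ : ∀ {k n} → Vec k → Mat k n → Vec n
  (x ⋆ G) j = sum λ i → x i * G i j

  _▹_ : ∀ {k n} → Mat k n → Vec n → Vec k
  (A ▹ a) i = sum λ t → A i t * a t

  I : ∀ {k} → Mat k k
  I i j with i Fin.≟ j
  ... | yes _ = 1#
  ... | no  _ = 0#

  permMat : ∀ {n} → Permutation′ n → Mat n n
  permMat σ i j with (σ ⟨$⟩ʳ i) Fin.≟ j
  ... | yes _ = 1#
  ... | no  _ = 0#

  diag : ∀ {n} → Vec n → Mat n n
  diag d i j with i Fin.≟ j
  ... | yes _ = d i
  ... | no  _ = 0#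

  IsMonomial : ∀ {n} → Mat n n → Set (c ⊔ ℓ)
  IsMonomial {n} M = ∃[ σ ] ∃[ d ]
    ((∀ j → ¬ (d j ≈ 0#)) × M ≈ₘ (permMat σ · diag d))

  Invertible : ∀ {k} → Mat k k → Set (c ⊔ ℓ)
  Invertible A = ∃[ B ] ((A · B) ≈ₘ I × (B · A) ≈ₘ I)

  Code : ℕ → Set (Level.suc (c ⊔ ℓ))
  Code n = Vec n → Set (c ⊔ ℓ)

  ⟨_⟩ : ∀ {k n} → Mat k n → Code n
  ⟨ G ⟩ v = ∃[ x ] (v ≋ (x ⋆ G))

  _M*_ : ∀ {n} → Code n → Mat n n → Code n
  (C M* M) v = ∃[ u ] (C u × v ≋ (u ⋆ M))

  _≐_ : ∀ {n} → Code n → Code n → Set (c ⊔ ℓ)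
  C ≐ C′ = ∀ v → (C v → C′ v) × (C′ v → C v)

  RowsIndependent : ∀ {k n} → Mat k n → Set (c ⊔ ℓ)
  RowsIndependent G = ∀ x → (∀ j → (x ⋆ G) j ≈ 0#) → ∀ i → x i ≈ 0#

  InMAut : ∀ {k n} → Mat k n → Mat n n → Set (c ⊔ ℓ)
  InMAut G M = IsMonomial M × ((⟨ G ⟩ M* M) ≐ ⟨ G ⟩)

  InImF : ∀ {k n} → Mat k n → Mat k k → Set (c ⊔ ℓ)
  InImF G A = Invertible A × ∃[ P ] (InMAut G P × (A · G) ≈ₘ (G · P))

  SameOrbit : ∀ {k n} → Mat k n → Vec k → Vec k → Set (c ⊔ ℓ)
  SameOrbit G a b = ∃[ A ] (InImF G A × (A ▹ a) ≋ b)

  append : ∀ {k n} → Mat k n → (m : ℕ) → Vec k → Mat k (n ℕ.+ m)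
  append G m a i = G i ++ replicate m (a i)

  MonEquiv : ∀ {n} → Code n → Code n → Set (c ⊔ ℓ)
  MonEquiv {n} C C′ = ∃[ M ] (IsMonomial M × (C′ ≐ (C M* M)))

-- Write A a^T = b^T with A G = G P, P = Perm(σ) diag(d) monomial, and let
-- P⁻¹ = Perm(σ⁻¹) diag(e), e_j = d_{σ j}⁻¹, be its (monomial) inverse.  Extend
-- P⁻¹ by the identity on the m appended coordinates to a monomial matrix M.
-- For every row vector y,
--   (yA)(G | a^T … a^T) M = ((yA) G P⁻¹ | yA a^T …) = (y G | y b^T …)
--                         = y (G | b^T … b^T),
-- because (yA) G = y G P.  Since A is invertible, yA ranges over all row
-- vectors, so the code generated by (G | b^T …) is the image under M of the
-- code generated by (G | a^T …).
module Submission where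

open import Defs
open import Data.Nat as ℕ using (ℕ; _≤_; suc)
open import Data.Fin using (Fin; splitAt; join; punchIn; _≟_)
open import Data.Fin.Properties using (splitAt-join; join-splitAt; punchInᵢ≢i)
open import Data.Fin.Permutation using (Permutation′; _⟨$⟩ʳ_; _⟨$⟩ˡ_; permutation; flip; inverseˡ; inverseʳ)
open import Data.Sum as Sum using (inj₁; inj₂; [_,_]′)
open import Data.Product using (_,_; proj₁; proj₂)
open import Data.Vec.Functional using (_++_; replicate)
open import Relation.Nullary using (¬_; yes; no)
open import Relation.Binary.PropositionalEquality as ≡ using (_≡_; _≢_)
open import Function using (id; _∘_)
open import Data.Empty using (⊥-elim)
import Algebra.Properties.Semiring.Sum as SemiringSum
import Data.Vec.Functional.Relation.Binary.Equality.Setoid as VecEquality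
import Relation.Binary.Reasoning.Setoid as SetoidReasoning

module _ (n m : ℕ) where

  onLeft : (Fin n → Fin n) → Fin (n ℕ.+ m) → Fin (n ℕ.+ m)
  onLeft f j = join n m (Sum.map f id (splitAt n j))

  onLeft-inverse : (f g : Fin n → Fin n) → (∀ x → f (g x) ≡ x) →
                   ∀ j → onLeft f (onLeft g j) ≡ j
  onLeft-inverse f g fg j = begin
    join n m (Sum.map f id (splitAt n (join n m (Sum.map g id s))))
      ≡⟨ ≡.cong (join n m ∘ Sum.map f id) (splitAt-join n m (Sum.map g id s)) ⟩
    join n m (Sum.map f id (Sum.map g id s))  ≡⟨ ≡.cong (join n m) (map-inverse s) ⟩
    join n m s                                ≡⟨ join-splitAt n m j ⟩
    j                                         ∎
    where
    open ≡.≡-Reasoning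
    s = splitAt n j
    map-inverse : ∀ t → Sum.map f id (Sum.map g id t) ≡ t
    map-inverse (inj₁ x) = ≡.cong inj₁ (fg x)
    map-inverse (inj₂ y) = ≡.refl

  extend : Permutation′ n → Permutation′ (n ℕ.+ m)
  extend σ = permutation (onLeft (σ ⟨$⟩ʳ_)) (onLeft (σ ⟨$⟩ˡ_))
    (onLeft-inverse _ _ (λ _ → inverseʳ σ)) (onLeft-inverse _ _ (λ _ → inverseˡ σ))

module LinearAlgebra {c ℓ} (F : Field c ℓ) where
  open Field F
  open FieldDefs F
  open SemiringSum semiring using (sum; sum-cong-≋; sum-replicate-zero; sum-remove;
                                   *-distribˡ-sum; *-distribʳ-sum; ∑-comm)
  open VecEquality setoid using (≋-setoid)

  ≋-sym : ∀ {n} {u v : Vec n} → u ≋ v → v ≋ u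
  ≋-sym p i = sym (p i)

  _⊙_ : ∀ {k} → Vec k → Vec k → Carrier
  x ⊙ a = sum λ i → x i * a i

  sum-single : ∀ {n} (f : Vec n) (i : Fin n) → (∀ j → j ≢ i → f j ≈ 0#) → sum f ≈ f i
  sum-single {suc n} f i off = begin
    sum f                             ≈⟨ sum-remove f ⟩
    f i + sum (λ j → f (punchIn′ j))  ≈⟨ +-congˡ (trans (sum-cong-≋ rest) (sum-replicate-zero n)) ⟩
    f i + 0#                          ≈⟨ +-identityʳ (f i) ⟩
    f i                               ∎
    where
    open SetoidReasoning setoid
    punchIn′ = punchIn i
    rest : ∀ j → f (punchIn′ j) ≈ 0#
    rest j = off (punchIn′ j) (punchInᵢ≢i i j)

  ⊙-assoc : ∀ {k l} (y : Vec k) (A : Mat k l) (a : Vec l) → (y ⋆ A) ⊙ a ≈ y ⊙ (A ▹ a)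
  ⊙-assoc y A a = begin
    sum (λ i → sum (λ t → y t * A t i) * a i)
      ≈⟨ sum-cong-≋ (λ i → *-distribʳ-sum (a i) (λ t → y t * A t i)) ⟩
    sum (λ i → sum (λ t → (y t * A t i) * a i))  ≈⟨ ∑-comm (λ i t → (y t * A t i) * a i) ⟩
    sum (λ t → sum (λ i → (y t * A t i) * a i))
      ≈⟨ sum-cong-≋ (λ t → sum-cong-≋ (λ i → *-assoc (y t) (A t i) (a i))) ⟩
    sum (λ t → sum (λ i → y t * (A t i * a i)))
      ≈⟨ sum-cong-≋ (λ t → sym (*-distribˡ-sum (y t) (λ i → A t i * a i))) ⟩
    sum (λ t → y t * (A ▹ a) t)                  ∎
    where open SetoidReasoning setoid

  ⋆-assoc : ∀ {k l n} (y : Vec k) (A : Mat k l) (G : Mat l n) → ((y ⋆ A) ⋆ G) ≋ (y ⋆ (A · G))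
  ⋆-assoc y A G j = ⊙-assoc y A (λ t → G t j)

  ⋆-congʳ : ∀ {k n} (x : Vec k) {A B : Mat k n} → A ≈ₘ B → (x ⋆ A) ≋ (x ⋆ B)
  ⋆-congʳ x A≈B j = sum-cong-≋ (λ i → *-congˡ (A≈B i j))

  ·-congˡ : ∀ {k l n} (A : Mat k l) {B C : Mat l n} → B ≈ₘ C → (A · B) ≈ₘ (A · C)
  ·-congˡ A B≈C i j = sum-cong-≋ (λ t → *-congˡ (B≈C t j))

  ⋆-congˡ : ∀ {k n} {x y : Vec k} (A : Mat k n) → x ≋ y → (x ⋆ A) ≋ (y ⋆ A)
  ⋆-congˡ A x≋y j = sum-cong-≋ (λ i → *-congʳ (x≋y i))

  ⋆-intertwine : ∀ {k n} {A : Mat k k} {G : Mat k n} {P : Mat n n} →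
                 (A · G) ≈ₘ (G · P) → ∀ y → ((y ⋆ A) ⋆ G) ≋ ((y ⋆ G) ⋆ P)
  ⋆-intertwine {n = n} {A = A} {G} {P} AG≈GP y = begin
    (y ⋆ A) ⋆ G  ≈⟨ ⋆-assoc y A G ⟩
    y ⋆ (A · G)  ≈⟨ ⋆-congʳ y AG≈GP ⟩
    y ⋆ (G · P)  ≈⟨ ≋-sym (⋆-assoc y G P) ⟩
    (y ⋆ G) ⋆ P  ∎
    where open SetoidReasoning (≋-setoid n)

  ⋆-single : ∀ {k n} (x : Vec k) (A : Mat k n) (r : Fin k) (j : Fin n) →
             (∀ i → i ≢ r → A i j ≈ 0#) → (x ⋆ A) j ≈ x r * A r j
  ⋆-single x A r j off = sum-single (λ i → x i * A i j) r
    (λ i i≢r → trans (*-congˡ (off i i≢r)) (zeroʳ (x i)))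

  I-off : ∀ {k} (i j : Fin k) → i ≢ j → I i j ≈ 0#
  I-off i j i≢j with i ≟ j
  ... | yes i≡j = ⊥-elim (i≢j i≡j)
  ... | no _    = refl

  I-on : ∀ {k} (j : Fin k) → I j j ≈ 1#
  I-on j with j ≟ j
  ... | yes _   = refl
  ... | no j≢j  = ⊥-elim (j≢j ≡.refl)

  diag-off : ∀ {n} (d : Vec n) (i j : Fin n) → i ≢ j → diag d i j ≈ 0#
  diag-off d i j i≢j with i ≟ j
  ... | yes i≡j = ⊥-elim (i≢j i≡j)
  ... | no _    = refl

  diag-on : ∀ {n} (d : Vec n) (j : Fin n) → diag d j j ≈ d j
  diag-on d j with j ≟ j
  ... | yes _   = refl
  ... | no j≢j  = ⊥-elim (j≢j ≡.refl)

  permMat-off : ∀ {n} (σ : Permutation′ n) (i j : Fin n) → σ ⟨$⟩ʳ i ≢ j → permMat σ i j ≈ 0#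
  permMat-off σ i j σi≢j with (σ ⟨$⟩ʳ i) ≟ j
  ... | yes σi≡j = ⊥-elim (σi≢j σi≡j)
  ... | no _     = refl

  permMat-on : ∀ {n} (σ : Permutation′ n) (i j : Fin n) → σ ⟨$⟩ʳ i ≡ j → permMat σ i j ≈ 1#
  permMat-on σ i j σi≡j with (σ ⟨$⟩ʳ i) ≟ j
  ... | yes _     = refl
  ... | no σi≢j   = ⊥-elim (σi≢j σi≡j)

  ⋆-I : ∀ {k} (x : Vec k) → (x ⋆ I) ≋ x
  ⋆-I x j = trans (⋆-single x I j j (λ i i≢j → I-off i j i≢j))
                  (trans (*-congˡ (I-on j)) (*-identityʳ (x j)))

  ⋆-diag : ∀ {n} (x d : Vec n) → (x ⋆ diag d) ≋ (λ j → x j * d j)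
  ⋆-diag x d j = trans (⋆-single x (diag d) j j (λ i i≢j → diag-off d i j i≢j))
                       (*-congˡ (diag-on d j))

  ⋆-permMat : ∀ {n} (x : Vec n) (σ : Permutation′ n) → (x ⋆ permMat σ) ≋ (λ j → x (σ ⟨$⟩ˡ j))
  ⋆-permMat x σ j = trans (⋆-single x (permMat σ) (σ ⟨$⟩ˡ j) j off)
    (trans (*-congˡ (permMat-on σ (σ ⟨$⟩ˡ j) j (inverseʳ σ))) (*-identityʳ _))
    where
    off : ∀ i → i ≢ σ ⟨$⟩ˡ j → permMat σ i j ≈ 0#
    off i i≢σ⁻¹j = permMat-off σ i j (λ σi≡j → i≢σ⁻¹j (≡.trans (≡.sym (inverseˡ σ)) (≡.cong (σ ⟨$⟩ˡ_) σi≡j)))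

  ⋆-monomial : ∀ {n} (x : Vec n) (σ : Permutation′ n) (d : Vec n) →
               (x ⋆ (permMat σ · diag d)) ≋ (λ j → x (σ ⟨$⟩ˡ j) * d j)
  ⋆-monomial x σ d j = trans (sym (⋆-assoc x (permMat σ) (diag d) j))
    (trans (⋆-diag (x ⋆ permMat σ) d j) (*-congʳ (⋆-permMat x σ j)))

  _⁻¹⟨_⟩ : (x : Carrier) → ¬ (x ≈ 0#) → Carrier
  x ⁻¹⟨ x≉0 ⟩ = proj₁ (inverse x x≉0)

  ⁻¹-inverse : ∀ x (x≉0 : ¬ (x ≈ 0#)) → x * x ⁻¹⟨ x≉0 ⟩ ≈ 1#
  ⁻¹-inverse x x≉0 = proj₂ (inverse x x≉0)

  ⁻¹-nonzero : ∀ x (x≉0 : ¬ (x ≈ 0#)) → ¬ (x ⁻¹⟨ x≉0 ⟩ ≈ 0#)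
  ⁻¹-nonzero x x≉0 x⁻¹≈0 =
    0≉1 (trans (sym (zeroʳ x)) (trans (*-congˡ (sym x⁻¹≈0)) (⁻¹-inverse x x≉0)))

  monomial-undo : ∀ {n} (σ : Permutation′ n) (d e : Vec n) →
                  (∀ j → d (σ ⟨$⟩ʳ j) * e j ≈ 1#) →
                  ∀ w → ((w ⋆ (permMat σ · diag d)) ⋆ (permMat (flip σ) · diag e)) ≋ w
  monomial-undo σ d e de≈1 w j = begin
    ((w ⋆ (permMat σ · diag d)) ⋆ (permMat (flip σ) · diag e)) j
      ≈⟨ ⋆-monomial (w ⋆ (permMat σ · diag d)) (flip σ) e j ⟩
    (w ⋆ (permMat σ · diag d)) (σ ⟨$⟩ʳ j) * e j
      ≈⟨ *-congʳ (⋆-monomial w σ d (σ ⟨$⟩ʳ j)) ⟩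
    (w (σ ⟨$⟩ˡ (σ ⟨$⟩ʳ j)) * d (σ ⟨$⟩ʳ j)) * e j
      ≈⟨ *-assoc _ _ _ ⟩
    w (σ ⟨$⟩ˡ (σ ⟨$⟩ʳ j)) * (d (σ ⟨$⟩ʳ j) * e j)
      ≈⟨ *-cong (reflexive (≡.cong w (inverseˡ σ))) (de≈1 j) ⟩
    w j * 1#
      ≈⟨ *-identityʳ (w j) ⟩
    w j ∎
    where open SetoidReasoning setoid

  ++-cong : ∀ {n m} {u u′ : Vec n} {w w′ : Vec m} → u ≋ u′ → w ≋ w′ → (u ++ w) ≋ (u′ ++ w′)
  ++-cong {n} {m} {u} {u′} {w} {w′} u≋u′ w≋w′ j =
    Sum.[_,_] {C = λ s → [ u , w ]′ s ≈ [ u′ , w′ ]′ s} u≋u′ w≋w′ (splitAt n j)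

  extendMonomial : ∀ {n} (m : ℕ) (σ : Permutation′ n) (d : Vec n) → Mat (n ℕ.+ m) (n ℕ.+ m)
  extendMonomial {n} m σ d = permMat (extend n m σ) · diag (d ++ replicate m 1#)

  extendMonomial-isMonomial : ∀ {n} m σ (d : Vec n) → (∀ j → ¬ (d j ≈ 0#)) →
                              IsMonomial (extendMonomial m σ d)
  extendMonomial-isMonomial {n} m σ d d≉0 =
    extend n m σ , d ++ replicate m 1# , nonzero , λ _ _ → refl
    where
    nonzero : ∀ j → ¬ ((d ++ replicate m 1#) j ≈ 0#)
    nonzero j = Sum.[_,_] {C = λ s → ¬ ([ d , replicate m 1# ]′ s ≈ 0#)}
      d≉0 (λ _ 1≈0 → 0≉1 (sym 1≈0)) (splitAt n j)

  ⋆-extendMonomial : ∀ {n m} (σ : Permutation′ n) (d : Vec n) (u : Vec n) (w : Vec m) →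
                     ((u ++ w) ⋆ extendMonomial m σ d) ≋ ((u ⋆ (permMat σ · diag d)) ++ w)
  ⋆-extendMonomial {n} {m} σ d u w j = begin
    ((u ++ w) ⋆ extendMonomial m σ d) j
      ≈⟨ ⋆-monomial (u ++ w) (extend n m σ) (d ++ replicate m 1#) j ⟩
    (u ++ w) (join n m (Sum.map (σ ⟨$⟩ˡ_) id s)) * [ d , replicate m 1# ]′ s
      ≡⟨ ≡.cong (λ t → [ u , w ]′ t * [ d , replicate m 1# ]′ s) (splitAt-join n m (Sum.map (σ ⟨$⟩ˡ_) id s)) ⟩
    [ u , w ]′ (Sum.map (σ ⟨$⟩ˡ_) id s) * [ d , replicate m 1# ]′ s
      ≈⟨ blockwise s ⟩
    [ (λ i → u (σ ⟨$⟩ˡ i) * d i) , w ]′ s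
      ≈⟨ ++-cong {u = λ i → u (σ ⟨$⟩ˡ i) * d i} (≋-sym (⋆-monomial u σ d)) (λ _ → refl) j ⟩
    ((u ⋆ (permMat σ · diag d)) ++ w) j ∎
    where
    open SetoidReasoning setoid
    s = splitAt n j
    blockwise : ∀ t → [ u , w ]′ (Sum.map (σ ⟨$⟩ˡ_) id t) * [ d , replicate m 1# ]′ t
                      ≈ [ (λ i → u (σ ⟨$⟩ˡ i) * d i) , w ]′ t
    blockwise (inj₁ i) = refl
    blockwise (inj₂ i) = *-identityʳ (w i)

  ⋆-append : ∀ {k n} (G : Mat k n) (m : ℕ) (c x : Vec k) →
             (x ⋆ append G m c) ≋ ((x ⋆ G) ++ replicate m (x ⊙ c))
  ⋆-append {n = n} G m c x j = blockwise (splitAt n j)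
    where
    blockwise : ∀ t → sum (λ i → x i * [ G i , replicate m (c i) ]′ t)
                      ≈ [ x ⋆ G , replicate m (x ⊙ c) ]′ t
    blockwise (inj₁ _) = refl
    blockwise (inj₂ _) = refl

  generated-transport : ∀ {k n} {A B : Mat k k} {G H : Mat k n} {M : Mat n n} →
                        (B · A) ≈ₘ I → (∀ y → (((y ⋆ A) ⋆ G) ⋆ M) ≋ (y ⋆ H)) →
                        ⟨ H ⟩ ≐ (⟨ G ⟩ M* M)
  generated-transport {A = A} {B} {G} {H} {M} BA≈I transport v = into , outof
    where
    into : ⟨ H ⟩ v → (⟨ G ⟩ M* M) v
    into (y , v≋yH) = (y ⋆ A) ⋆ G , (y ⋆ A , λ _ → refl) ,
                      λ j → trans (v≋yH j) (sym (transport y j))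

    outof : (⟨ G ⟩ M* M) v → ⟨ H ⟩ v
    outof (u , (x , u≋xG) , v≋uM) = x ⋆ B , λ j →
      trans (v≋uM j) (trans (⋆-congˡ M u≋xG j)
        (trans (⋆-congˡ M (⋆-congˡ G x≋xBA) j) (transport (x ⋆ B) j)))
      where
      x≋xBA : x ≋ ((x ⋆ B) ⋆ A)
      x≋xBA i = sym (trans (⋆-assoc x B A i) (trans (⋆-congʳ x BA≈I i) (⋆-I x i)))

  append-transport : ∀ {k n} (G : Mat k n) (m : ℕ) {a b : Vec k} {A : Mat k k}
                     {σ : Permutation′ n} {d e : Vec n} →
                     (A · G) ≈ₘ (G · (permMat σ · diag d)) → (A ▹ a) ≋ b →
                     (∀ j → d (σ ⟨$⟩ʳ j) * e j ≈ 1#) →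
                     ∀ y → (((y ⋆ A) ⋆ append G m a) ⋆ extendMonomial m (flip σ) e)
                           ≋ (y ⋆ append G m b)
  append-transport {n = n} G m {a} {b} {A} {σ} {d} {e} AG≈GP Aa≋b de≈1 y = begin
    ((y ⋆ A) ⋆ append G m a) ⋆ M
      ≈⟨ ⋆-congˡ M (⋆-append G m a (y ⋆ A)) ⟩
    (((y ⋆ A) ⋆ G) ++ replicate m ((y ⋆ A) ⊙ a)) ⋆ M
      ≈⟨ ⋆-extendMonomial (flip σ) e ((y ⋆ A) ⋆ G) _ ⟩
    (((y ⋆ A) ⋆ G) ⋆ P⁻¹) ++ replicate m ((y ⋆ A) ⊙ a)
      ≈⟨ ++-cong restoreG (λ _ → trans (⊙-assoc y A a) (sum-cong-≋ λ t → *-congˡ (Aa≋b t))) ⟩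
    (y ⋆ G) ++ replicate m (y ⊙ b)
      ≈⟨ ≋-sym (⋆-append G m b y) ⟩
    y ⋆ append G m b ∎
    where
    open SetoidReasoning (≋-setoid (n ℕ.+ m))
    M = extendMonomial m (flip σ) e
    P⁻¹ = permMat (flip σ) · diag e
    restoreG : (((y ⋆ A) ⋆ G) ⋆ P⁻¹) ≋ (y ⋆ G)
    restoreG j = trans (⋆-congˡ P⁻¹ (⋆-intertwine AG≈GP y) j)
                       (monomial-undo σ d e de≈1 (y ⋆ G) j)

  sameOrbit⇒monEquiv : ∀ {k n} (G : Mat k n) (m : ℕ) (a b : Vec k) →
                       SameOrbit G a b → MonEquiv ⟨ append G m a ⟩ ⟨ append G m b ⟩
  sameOrbit⇒monEquiv G m a b
    (A , ((B , _ , BA≈I) , P , ((σ , d , d≉0 , P≈σd) , _) , AG≈GP) , Aa≋b) =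
    extendMonomial m (flip σ) e ,
    extendMonomial-isMonomial m (flip σ) e (λ j → ⁻¹-nonzero _ (d≉0 (σ ⟨$⟩ʳ j))) ,
    generated-transport BA≈I (append-transport G m AG≈Gσd Aa≋b de≈1)
    where
    -- the weights of the inverse monomial matrix P⁻¹ = Perm(σ⁻¹) diag(e)
    e : Vec _
    e j = d (σ ⟨$⟩ʳ j) ⁻¹⟨ d≉0 (σ ⟨$⟩ʳ j) ⟩

    de≈1 : ∀ j → d (σ ⟨$⟩ʳ j) * e j ≈ 1#
    de≈1 j = ⁻¹-inverse _ (d≉0 (σ ⟨$⟩ʳ j))

    AG≈Gσd : (A · G) ≈ₘ (G · (permMat σ · diag d))
    AG≈Gσd i j = trans (AG≈GP i j) (·-congˡ G P≈σd i j)

lemma2p1 : ∀ {c ℓ} (q : ℕ) → IsPrimePower q → (F : Field c ℓ) → HasSize F q →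
    let open FieldDefs F in
    ∀ (n k : ℕ) (G₁ : Mat k n) → RowsIndependent G₁ →
    ∀ (m : ℕ) → 1 ≤ m → (a b : Vec k) →
    SameOrbit G₁ a b →
    MonEquiv ⟨ append G₁ m a ⟩ ⟨ append G₁ m b ⟩
lemma2p1 _ _ F _ n k G₁ _ m _ a b orbit = LinearAlgebra.sameOrbit⇒monEquiv F G₁ m a b orbit
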